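{- Let $G$ be a (finite, simple, connected) graph of order $n$ such that $\tau(G)=\tau>\frac{n}{2}$. If its $\tau$-set $W$ induces an edgeless graph ($G[W]\cong\overline{K_\tau}$), then $\beta_p(G)=\tau$.
   Context: Two vertices $u,v$ are twins if $N(u)\setminus\{v\}=N(v)\setminus\{u\}$. A twin set is a set of pairwise twin vertices; twin classes are the equivalence classes of the twin relation and $\tau(G)$ is the maximum cardinality of a twin class. A $\tau$-set is a twin set of cardinality $\tau(G)$ (when $\tau(G)>n/2$ it is unique). $G[W]$ is the subgraph induced by $W$. For $u$ a vertex and $S$ a vertex set, $d(u,S)=\min_{w\in S}d(u,w)$. A partition $\Pi=\{S_1,\dots,S_k\}$ of $V(G)$ is locating if the vectors $r(u|\Pi)=(d(u,S_1),\dots,d(u,S_k))$ are pairwise distinct over $u\in V(G)$; $\beta_p(G)$ is the minimum size of a locating partition. -}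

module Defs where

open import Data.Nat using (ℕ; zero; suc; _≤_)
open import Data.Fin using (Fin)
open import Data.Fin.Subset using (Subset; _∈_; _∉_; ∣_∣)
open import Data.Product using (Σ; ∃; _×_; _,_)
open import Relation.Nullary using (¬_; Dec)
open import Relation.Binary.PropositionalEquality using (_≡_; _≢_)
open import Function.Bundles using (_⇔_)
open import Function.Definitions using (Surjective)

record Graph (n : ℕ) : Set₁ where
  field
    Adj       : Fin n → Fin n → Set
    adj?      : ∀ u v → Dec (Adj u v)
    symmetric : ∀ {u v} → Adj u v → Adj v u
    irrefl    : ∀ {u} → ¬ Adj u u

module _ {n : ℕ} (G : Graph n) where
  open Graph G

  data Walk : ℕ → Fin n → Fin n → Set where
    here : ∀ {u} → Walk zero u u
    step : ∀ {k u v w} → Adj u v → Walk k v w → Walk (suc k) u w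

  Connected : Set
  Connected = ∀ u v → ∃ λ k → Walk k u v

  IsDist : Fin n → Fin n → ℕ → Set
  IsDist u v k = Walk k u v × (∀ m → Walk m u v → k ≤ m)

  Twins : Fin n → Fin n → Set
  Twins u v = ∀ w → w ≢ u → w ≢ v → (Adj u w ⇔ Adj v w)

  TwinSet : Subset n → Set
  TwinSet W = ∀ u v → u ∈ W → v ∈ W → Twins u v

  TwinClass : Subset n → Set
  TwinClass W = (∃ λ u → u ∈ W) × TwinSet W
              × (∀ u v → u ∈ W → Twins u v → v ∈ W)

  IsTau : ℕ → Set
  IsTau t = (∃ λ W → TwinClass W × ∣ W ∣ ≡ t)
          × (∀ W → TwinClass W → ∣ W ∣ ≤ t)

  TauSet : ℕ → Subset n → Set
  TauSet t W = TwinSet W × ∣ W ∣ ≡ t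

  Independent : Subset n → Set
  Independent W = ∀ u v → u ∈ W → v ∈ W → ¬ Adj u v

  Partition : ℕ → Set
  Partition k = Σ (Fin n → Fin k) Surjective′
    where Surjective′ : (Fin n → Fin k) → Set
          Surjective′ f = ∀ i → ∃ λ u → f u ≡ i

  IsSetDist : ∀ {k} → (Fin n → Fin k) → Fin n → Fin k → ℕ → Set
  IsSetDist p u i d =
    (∃ λ w → p w ≡ i × IsDist u w d)
    × (∀ w e → p w ≡ i → IsDist u w e → d ≤ e)

  Locating : ∀ {k} → (Fin n → Fin k) → Set
  Locating p = ∀ u v → u ≢ v →
    ∃ λ i → ∃ λ a → ∃ λ b → IsSetDist p u i a × IsSetDist p v i b × a ≢ b

  IsPartitionDim : ℕ → Set
  IsPartitionDim k =
    (Σ (Partition k) λ P → Locating (Data.Product.proj₁ P))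
    × (∀ m → (P : Partition m) → Locating (Data.Product.proj₁ P) → k ≤ m)

module Submission where

-- Two non-adjacent twins have the same distance to every vertex
-- other than themselves, so if they lie in the same class of a partition they
-- have the same distance vector.  Hence a locating partition puts the τ vertices
-- of W into pairwise different classes and has at least τ classes.
--
-- Number the vertices of W as w₀ … w_{τ-1} and the n - τ < τ
-- vertices outside W as z₀ … z_{n-τ-1}, and let class k be {w_k, z_k} (just
-- {w_k} when k ≥ n - τ).  In particular class n - τ is the singleton {w_{n-τ}}.
-- If w_k and z_k had the same distance vector, then z_k has no neighbour in W
-- (else it would be adjacent to w_{n-τ}, forcing w_k to be adjacent to it too)
-- and the same neighbours as w_k outside W; so w_k and z_k would be twins, and
-- the twin class of w_k would be larger than τ.  Hence the partition is locating.

open import Defs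
open import Data.Bool using (Bool; true; false; if_then_else_)
import Data.Bool as Bool
open import Data.Nat using (ℕ; zero; suc; _+_; _*_; _≤_; _<_; z≤n; s≤s)
import Data.Nat as ℕ
open import Data.Nat.Properties
  using (suc-injective; 0≢1+n; n≤0⇒n≡0; ≤-refl; ≤-antisym; <-irrefl; <-≤-trans; <⇒≤;
         +-suc; +-identityʳ; +-cancelˡ-<)
open import Data.Fin using (Fin; zero; suc; toℕ; fromℕ<; _≟_)
open import Data.Fin.Properties
  using (any?; all?; ¬∀⟶∃¬; toℕ-fromℕ<; toℕ-injective; toℕ<n; injective⇒≤)
open import Data.Fin.Subset using (Subset; _∈_; _∉_; ∣_∣)
open import Data.Fin.Subset.Properties using (_∈?_; p⊂q⇒∣p∣<∣q∣)
open import Data.Vec using ([]; _∷_; lookup; tabulate; count)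
open import Data.Vec.Properties using ([]=⇒lookup; lookup⇒[]=; lookup∘tabulate)
open import Data.Product using (Σ; ∃; _×_; _,_; proj₁; proj₂)
open import Data.Empty using (⊥-elim)
open import Relation.Nullary using (¬_; Dec; yes; no; does)
open import Relation.Nullary.Decidable using (map′; _×-dec_; _→-dec_; ¬?; dec-true)
open import Relation.Binary.PropositionalEquality
open import Function using (_∘_; id)
open import Function.Bundles using (_⇔_; mk⇔; Equivalence)
open Equivalence

-- The step of `count (_≟ c)` on an entry b: add one exactly when b ≡ c.
countStep : Bool → Bool → ℕ → ℕ
countStep b c = if does (b Bool.≟ c) then suc else id

countStep-same : ∀ b k → countStep b b k ≡ suc k
countStep-same true  k = refl
countStep-same false k = refl

countStep-differ : ∀ {b c} k → b ≢ c → countStep b c k ≡ k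
countStep-differ {b} {c} k b≢c with b Bool.≟ c
... | yes b≡c = ⊥-elim (b≢c b≡c)
... | no  _   = refl

countStep-injective : ∀ b c {k l} → countStep b c k ≡ countStep b c l → k ≡ l
countStep-injective b c with does (b Bool.≟ c)
... | true  = suc-injective
... | false = id

countStep-mono-< : ∀ b c {k l} → k < l → countStep b c k < countStep b c l
countStep-mono-< b c with does (b Bool.≟ c)
... | true  = s≤s
... | false = id

-- The number of vertices on side b of W (inside for true, outside for false).
-- `side true W` is ∣ W ∣ by definition.
side : ∀ {n} → Bool → Subset n → ℕ
side b = count (Bool._≟ b)

side-split : ∀ {n} (W : Subset n) → ∣ W ∣ + side false W ≡ n
side-split []          = refl
side-split (true  ∷ W) = cong suc (side-split W)
side-split (false ∷ W) = trans (+-suc ∣ W ∣ (side false W)) (cong suc (side-split W))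

-- The rank of v in W: the number of vertices before v on the same side of W
-- as v.  It numbers the members of W, and separately the non-members, from 0.
rank : ∀ {n} → Subset n → Fin n → ℕ
rank (b ∷ W) zero    = 0
rank (b ∷ W) (suc v) = countStep b (lookup W v) (rank W v)

rank-suc-same : ∀ {n} {b} (W : Subset n) v → b ≡ lookup W v →
                rank (b ∷ W) (suc v) ≡ suc (rank W v)
rank-suc-same {b = b} W v refl = countStep-same b (rank W v)

rank-injective : ∀ {n} (W : Subset n) {u v} →
                 lookup W u ≡ lookup W v → rank W u ≡ rank W v → u ≡ v
rank-injective (b ∷ W) {zero}  {zero}  _    _ = refl
rank-injective (b ∷ W) {zero}  {suc v} same r =
  ⊥-elim (0≢1+n (trans r (rank-suc-same W v same)))
rank-injective (b ∷ W) {suc u} {zero}  same r =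
  ⊥-elim (0≢1+n (trans (sym r) (rank-suc-same W u (sym same))))
rank-injective (b ∷ W) {suc u} {suc v} same r =
  cong suc (rank-injective W same (countStep-injective b (lookup W u) r′))
  where
    r′ : countStep b (lookup W u) (rank W u) ≡ countStep b (lookup W u) (rank W v)
    r′ = trans r (cong (λ c → countStep b c (rank W v)) (sym same))

rank<side : ∀ {n} (W : Subset n) v → rank W v < side (lookup W v) W
rank<side (b ∷ W) zero    = subst (0 <_) (sym (countStep-same b (side b W))) (s≤s z≤n)
rank<side (b ∷ W) (suc v) = countStep-mono-< b (lookup W v) (rank<side W v)

rank-surjective : ∀ {n} (W : Subset n) b {k} → k < side b W →
                  ∃ λ v → lookup W v ≡ b × rank W v ≡ k
rank-surjective (c ∷ W) b {k} k< with c Bool.≟ b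
... | yes refl = first k k<
  where
    first : ∀ k → k < suc (side c W) → ∃ λ v → lookup (c ∷ W) v ≡ c × rank (c ∷ W) v ≡ k
    first zero    _         = zero , refl , refl
    first (suc k) (s≤s k<′) with rank-surjective W c k<′
    ... | v , lv , rv = suc v , lv , trans (rank-suc-same W v (sym lv)) (cong suc rv)
... | no c≢b with rank-surjective W b k<
...   | v , lv , rv =
  suc v , lv , trans (countStep-differ (rank W v) (λ e → c≢b (trans e lv))) rv

member : ∀ {n} (W : Subset n) → Fin ∣ W ∣ → Fin n
member W k = proj₁ (rank-surjective W true (toℕ<n k))

member-∈ : ∀ {n} (W : Subset n) k → member W k ∈ W
member-∈ W k = lookup⇒[]= (member W k) W (proj₁ (proj₂ (rank-surjective W true (toℕ<n k))))

rank-member : ∀ {n} (W : Subset n) k → rank W (member W k) ≡ toℕ k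
rank-member W k = proj₂ (proj₂ (rank-surjective W true (toℕ<n k)))

member-injective : ∀ {n} (W : Subset n) {k l} → member W k ≡ member W l → k ≡ l
member-injective W {k} {l} e =
  toℕ-injective (trans (sym (rank-member W k)) (trans (cong (rank W) e) (rank-member W l)))

∈⇒lookup : ∀ {n} {W : Subset n} {v} → v ∈ W → lookup W v ≡ true
∈⇒lookup = []=⇒lookup

∉⇒lookup : ∀ {n} (W : Subset n) v → v ∉ W → lookup W v ≡ false
∉⇒lookup W v v∉W with lookup W v in eq
... | true  = ⊥-elim (v∉W (lookup⇒[]= v W eq))
... | false = refl

-- The partition of the upper bound, for any W of size τ with n < 2τ: class k
-- consists of the vertices of rank k on either side of W.  Since fewer than τ
-- vertices lie outside W, class `lonely` (index n - τ) is a single vertex of W.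
module Pairing {n : ℕ} (W : Subset n) (n<2τ : n < 2 * ∣ W ∣) where

  τ : ℕ
  τ = ∣ W ∣

  outside<τ : side false W < τ
  outside<τ = +-cancelˡ-< τ (side false W) τ (subst (_< τ + τ) (sym (side-split W)) n<τ+τ)
    where
      n<τ+τ : n < τ + τ
      n<τ+τ = subst (n <_) (cong (τ +_) (+-identityʳ τ)) n<2τ

  side≤τ : ∀ b → side b W ≤ τ
  side≤τ true  = ≤-refl
  side≤τ false = <⇒≤ outside<τ

  classOf : Fin n → Fin τ
  classOf v = fromℕ< (<-≤-trans (rank<side W v) (side≤τ (lookup W v)))

  toℕ-classOf : ∀ v → toℕ (classOf v) ≡ rank W v
  toℕ-classOf v = toℕ-fromℕ< _

  classOf-injective : ∀ {u v} → lookup W u ≡ lookup W v → classOf u ≡ classOf v → u ≡ v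
  classOf-injective {u} {v} same e =
    rank-injective W same (trans (sym (toℕ-classOf u)) (trans (cong toℕ e) (toℕ-classOf v)))

  classOf-injective-∈ : ∀ {u v} → u ∈ W → v ∈ W → classOf u ≡ classOf v → u ≡ v
  classOf-injective-∈ u∈W v∈W =
    classOf-injective (trans (∈⇒lookup u∈W) (sym (∈⇒lookup v∈W)))

  classOf-injective-∉ : ∀ {u v} → u ∉ W → v ∉ W → classOf u ≡ classOf v → u ≡ v
  classOf-injective-∉ {u} {v} u∉W v∉W =
    classOf-injective (trans (∉⇒lookup W u u∉W) (sym (∉⇒lookup W v v∉W)))

  memberOf : ∀ i → ∃ λ w → w ∈ W × classOf w ≡ i
  memberOf i = member W i , member-∈ W i , toℕ-injective (trans (toℕ-classOf _) (rank-member W i))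

  classOf-surjective : ∀ i → ∃ λ v → classOf v ≡ i
  classOf-surjective i with memberOf i
  ... | w , _ , cw = w , cw

  lonely : Fin τ
  lonely = fromℕ< outside<τ

  lonely⊆W : ∀ {y} → classOf y ≡ lonely → y ∈ W
  lonely⊆W {y} e with y ∈? W
  ... | yes y∈W = y∈W
  ... | no  y∉W = ⊥-elim (<-irrefl rank≡outside rank<outside)
    where
      rank<outside : rank W y < side false W
      rank<outside = subst (λ b → rank W y < side b W) (∉⇒lookup W y y∉W) (rank<side W y)
      rank≡outside : rank W y ≡ side false W
      rank≡outside = trans (sym (toℕ-classOf y)) (trans (cong toℕ e) (toℕ-fromℕ< outside<τ))

least : (P : ℕ → Set) → (∀ k → Dec (P k)) → ∀ K → P K →
        Σ ℕ λ k → P k × (∀ m → P m → k ≤ m)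
least P P? zero    pK = 0 , pK , λ _ _ → z≤n
least P P? (suc K) pK with P? 0
... | yes p0 = 0 , p0 , λ _ _ → z≤n
... | no ¬p0 with least (P ∘ suc) (P? ∘ suc) K pK
...   | k , pk , minimal =
  suc k , pk , λ { zero p → ⊥-elim (¬p0 p) ; (suc m) p → s≤s (minimal m p) }

-- Distances in a graph.  Walks of a given length are decidable, so distances
-- to a class of a partition can be computed by the least number principle.
module _ {n : ℕ} (G : Graph n) where
  open Graph G

  walk? : ∀ k u v → Dec (Walk G k u v)
  walk? zero u v with u ≟ v
  ... | yes refl = yes here
  ... | no  u≢v  = no λ { here → u≢v refl }
  walk? (suc k) u v = map′ (λ (x , a , r) → step a r) unstep
                           (any? (λ x → adj? u x ×-dec walk? k x v))
    where
      unstep : Walk G (suc k) u v → ∃ λ x → Adj u x × Walk G k x v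
      unstep (step {v = x} a r) = x , a , r

  setDist-unique : ∀ {m} {p : Fin n → Fin m} {v i a b} →
                   IsSetDist G p v i a → IsSetDist G p v i b → a ≡ b
  setDist-unique ((w , pw , dw) , a-min) ((w′ , pw′ , dw′) , b-min) =
    ≤-antisym (a-min w′ _ pw′ dw′) (b-min w _ pw dw)

  module SetDistance (conn : Connected G) {m : ℕ} (p : Fin n → Fin m)
                     (surj : ∀ i → ∃ λ u → p u ≡ i) where

    WalkInto : Fin n → Fin m → ℕ → Set
    WalkInto u i k = ∃ λ w → p w ≡ i × Walk G k u w

    shortest : ∀ u i → Σ ℕ λ k → WalkInto u i k × (∀ l → WalkInto u i l → k ≤ l)
    shortest u i with surj i
    ... | w , pw with conn u w
    ...   | K , r = least (WalkInto u i) walkInto? K (w , pw , r)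
      where
        walkInto? : ∀ k → Dec (WalkInto u i k)
        walkInto? k = any? (λ w → (p w ≟ i) ×-dec walk? k u w)

    setDist : Fin n → Fin m → ℕ
    setDist u i = proj₁ (shortest u i)

    setDist-walk : ∀ u i → WalkInto u i (setDist u i)
    setDist-walk u i = proj₁ (proj₂ (shortest u i))

    setDist-minimal : ∀ {u i k} → WalkInto u i k → setDist u i ≤ k
    setDist-minimal {u} {i} {k} = proj₂ (proj₂ (shortest u i)) k

    setDist-isSetDist : ∀ u i → IsSetDist G p u i (setDist u i)
    setDist-isSetDist u i with setDist-walk u i
    ... | w , pw , r = (w , pw , r , λ k r′ → setDist-minimal (w , pw , r′))
                     , λ w′ e pw′ d → setDist-minimal (w′ , pw′ , proj₁ d)

    locating : (∀ u v → (∀ i → setDist u i ≡ setDist v i) → u ≡ v) → Locating G p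
    locating vectors-injective u v u≢v
      with ¬∀⟶∃¬ m (λ i → setDist u i ≡ setDist v i) (λ i → setDist u i ℕ.≟ setDist v i)
                 (u≢v ∘ vectors-injective u v)
    ... | i , differ = i , setDist u i , setDist v i
                     , setDist-isSetDist u i , setDist-isSetDist v i , differ

    setDist-own : ∀ u → setDist u (p u) ≡ 0
    setDist-own u = n≤0⇒n≡0 (setDist-minimal (u , refl , here))

    setDist-zero : ∀ {u i} → setDist u i ≡ 0 → p u ≡ i
    setDist-zero {u} {i} e with setDist u i | setDist-walk u i
    setDist-zero refl | .0 | w , pw , here = pw

    setDist-neighbour : ∀ {u y} → Adj u y → setDist u (p y) ≤ 1
    setDist-neighbour a = setDist-minimal (_ , refl , step a here)

    setDist-one : ∀ {u i} → setDist u i ≤ 1 → p u ≢ i → ∃ λ y → p y ≡ i × Adj u y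
    setDist-one {u} {i} le pu≢i with setDist u i | setDist-walk u i
    ... | .0          | w , pw , here           = ⊥-elim (pu≢i pw)
    ... | .1          | w , pw , step a here    = w , pw , a
    ... | suc (suc _) | _ with le
    ...   | s≤s ()

module _ {n : ℕ} (G : Graph n) where
  open Graph G

  twins? : ∀ u v → Dec (Twins G u v)
  twins? u v = all? λ x → ¬? (x ≟ u) →-dec (¬? (x ≟ v) →-dec iff? (adj? u x) (adj? v x))
    where
      iff? : ∀ {A B : Set} → Dec A → Dec B → Dec (A ⇔ B)
      iff? a b = map′ (λ (f , g) → mk⇔ f g) (λ e → to e , from e)
                      ((a →-dec b) ×-dec (b →-dec a))

  twins-refl : ∀ u → Twins G u u
  twins-refl u _ _ _ = mk⇔ id id

  twins-sym : ∀ {u v} → Twins G u v → Twins G v u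
  twins-sym t y y≢v y≢u = mk⇔ (from (t y y≢u y≢v)) (to (t y y≢u y≢v))

  -- The only delicate vertex is y = v, where Adj u v ⇔ Adj x u ⇔ Adj x v,
  -- using v, x twins at u and u, v twins at x.
  twins-trans : ∀ {u v x} → Twins G u v → Twins G v x → Twins G u x
  twins-trans {u} {v} {x} t₁ t₂ y y≢u y≢x with y ≟ v
  ... | no y≢v = mk⇔ (to (t₂ y y≢v y≢x) ∘ to (t₁ y y≢u y≢v))
                     (from (t₁ y y≢u y≢v) ∘ from (t₂ y y≢v y≢x))
  ... | yes refl with u ≟ x
  ...   | yes refl = mk⇔ id id
  ...   | no u≢x   = mk⇔ forward backward
    where
      x≢u : x ≢ u
      x≢u = u≢x ∘ sym
      forward : Adj u y → Adj x y
      forward a =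
        symmetric (to (t₁ x x≢u (y≢x ∘ sym)) (symmetric (to (t₂ u (y≢u ∘ sym) u≢x) (symmetric a))))
      backward : Adj x y → Adj u y
      backward a =
        symmetric (from (t₂ u (y≢u ∘ sym) u≢x) (symmetric (from (t₁ x x≢u (y≢x ∘ sym)) (symmetric a))))

  twinsOf : Fin n → Subset n
  twinsOf w = tabulate (λ v → does (twins? w v))

  twinsOf-complete : ∀ {w v} → Twins G w v → v ∈ twinsOf w
  twinsOf-complete {w} {v} t =
    lookup⇒[]= v (twinsOf w) (trans (lookup∘tabulate _ v) (dec-true (twins? w v) t))

  twinsOf-sound : ∀ {w v} → v ∈ twinsOf w → Twins G w v
  twinsOf-sound {w} {v} v∈ =
    witness (twins? w v) (trans (sym (lookup∘tabulate _ v)) ([]=⇒lookup v∈))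
    where
      witness : ∀ {A : Set} (a? : Dec A) → does a? ≡ true → A
      witness (yes a) _ = a
      witness (no  _) ()

  twinsOf-isTwinClass : ∀ w → TwinClass G (twinsOf w)
  twinsOf-isTwinClass w =
      (w , twinsOf-complete (twins-refl w))
    , (λ a b a∈ b∈ → twins-trans (twins-sym (twinsOf-sound a∈)) (twinsOf-sound b∈))
    , (λ a b a∈ t → twinsOf-complete (twins-trans (twinsOf-sound a∈) t))

  -- A twin set of maximum size τ(G) is closed under twins: a twin z ∉ W of
  -- some w ∈ W would make the twin class of w strictly larger than W.
  tauSet-closed : ∀ {τ W} → IsTau G τ → TauSet G τ W →
                  ∀ {w z} → w ∈ W → z ∉ W → ¬ Twins G w z
  tauSet-closed {τ} {W} (_ , maximal) (twW , ∣W∣≡τ) {w} {z} w∈W z∉W t =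
    <-irrefl refl (<-≤-trans W<class class≤W)
    where
      W<class : ∣ W ∣ < ∣ twinsOf w ∣
      W<class = p⊂q⇒∣p∣<∣q∣ ( (λ {v} v∈W → twinsOf-complete (twW w v w∈W v∈W))
                            , z , twinsOf-complete t , z∉W)
      class≤W : ∣ twinsOf w ∣ ≤ ∣ W ∣
      class≤W = subst (∣ twinsOf w ∣ ≤_) (sym ∣W∣≡τ) (maximal _ (twinsOf-isTwinClass w))

module _ {n : ℕ} (G : Graph n) where
  open Graph G

  -- A walk from u to a vertex w ∉ {u, v} can start at a non-adjacent twin v
  -- of u instead: the first step of the walk goes to a common neighbour.
  walk-twin : ∀ {k u v w} → Twins G u v → ¬ Adj u v → w ≢ u → w ≢ v →
              Walk G k u w → Walk G k v w
  walk-twin t ¬uv w≢u w≢v here = ⊥-elim (w≢u refl)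
  walk-twin {u = u} {v} t ¬uv w≢u w≢v (step {v = x} u~x r) = step (to (t x x≢u x≢v) u~x) r
    where
      x≢u : x ≢ u
      x≢u refl = irrefl u~x
      x≢v : x ≢ v
      x≢v refl = ¬uv u~x

  dist-twin : ∀ {d u v w} → Twins G u v → ¬ Adj u v → w ≢ u → w ≢ v →
              IsDist G u w d → IsDist G v w d
  dist-twin t ¬uv w≢u w≢v (r , minimal) =
      walk-twin t ¬uv w≢u w≢v r
    , λ m r′ → minimal m (walk-twin (twins-sym G t) (¬uv ∘ symmetric) w≢v w≢u r′)

  setDist-twin : ∀ {m} (p : Fin n → Fin m) {u v i a} → Twins G u v → ¬ Adj u v →
                 p u ≡ p v → i ≢ p u → IsSetDist G p u i a → IsSetDist G p v i a
  setDist-twin p {u} {v} {i} t ¬uv pu≡pv i≢pu ((w , pw , dw) , minimal) =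
      (w , pw , dist-twin t ¬uv (≢u pw) (≢v pw) dw)
    , λ w′ e pw′ d →
        minimal w′ e pw′ (dist-twin (twins-sym G t) (¬uv ∘ symmetric) (≢v pw′) (≢u pw′) d)
    where
      ≢u : ∀ {w} → p w ≡ i → w ≢ u
      ≢u pw refl = i≢pu (sym pw)
      ≢v : ∀ {w} → p w ≡ i → w ≢ v
      ≢v pw refl = i≢pu (trans (sym pw) (sym pu≡pv))

  setDist-own-class : ∀ {m} {p : Fin n → Fin m} {u a} → IsSetDist G p u (p u) a → a ≡ 0
  setDist-own-class {u = u} (_ , minimal) = n≤0⇒n≡0 (minimal u 0 refl (here , λ _ _ → z≤n))

  locating-separates-twins : ∀ {m} {p : Fin n → Fin m} → Locating G p →
                             ∀ {u v} → u ≢ v → Twins G u v → ¬ Adj u v → p u ≢ p v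
  locating-separates-twins {p = p} loc {u} {v} u≢v t ¬uv pu≡pv with loc u v u≢v
  ... | i , a , b , da , db , a≢b with i ≟ p u
  ...   | no  i≢pu = a≢b (setDist-unique G (setDist-twin p t ¬uv pu≡pv i≢pu da) db)
  ...   | yes refl = a≢b (trans (setDist-own-class da) (sym (setDist-own-class db′)))
    where
      db′ : IsSetDist G p v (p v) b
      db′ = subst (λ j → IsSetDist G p v j b) pu≡pv db

  lowerBound : ∀ (W : Subset n) → TwinSet G W → Independent G W →
               ∀ m (P : Partition G m) → Locating G (proj₁ P) → ∣ W ∣ ≤ m
  lowerBound W twW indep m (p , _) loc = injective⇒≤ classOfMember-injective
    where
      classOfMember-injective : ∀ {k l} → p (member W k) ≡ p (member W l) → k ≡ l
      classOfMember-injective {k} {l} e with member W k ≟ member W l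
      ... | yes same = member-injective W same
      ... | no  diff = ⊥-elim (locating-separates-twins loc diff
                                 (twW _ _ (member-∈ W k) (member-∈ W l))
                                 (indep _ _ (member-∈ W k) (member-∈ W l)) e)

module UpperBound {n : ℕ} (G : Graph n) (conn : Connected G) (W : Subset n)
                  (twW : TwinSet G W) (indep : Independent G W) (n<2τ : n < 2 * ∣ W ∣)
                  (closed : ∀ {w z} → w ∈ W → z ∉ W → ¬ Twins G w z) where
  open Graph G
  open Pairing W n<2τ
  open SetDistance G conn classOf classOf-surjective

  SameVector : Fin n → Fin n → Set
  SameVector u v = ∀ i → setDist u i ≡ setDist v i

  -- Equal vectors force equal classes (the unique zero coordinate).
  sameVector⇒sameClass : ∀ {u v} → SameVector u v → classOf u ≡ classOf v
  sameVector⇒sameClass {u} {v} E = sym (setDist-zero (trans (sym (E (classOf u))) (setDist-own u)))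

  -- If b has a's vector and class but no neighbour in W, then b is adjacent to
  -- every neighbour of a outside W and outside their class: b has a neighbour
  -- in that class, which lies outside W and hence is the neighbour of a.
  neighbour-transfer : ∀ {a b} → SameVector a b → classOf a ≡ classOf b →
                       (∀ y → y ∈ W → ¬ Adj b y) →
                       ∀ {x} → x ∉ W → classOf a ≢ classOf x → Adj a x → Adj b x
  neighbour-transfer {a} {b} E ab noNeighbourInW {x} x∉W ab≢x a~x
    with setDist-one (subst (_≤ 1) (E (classOf x)) (setDist-neighbour a~x)) (ab≢x ∘ trans ab)
  ... | y , cy , b~y with y ∈? W
  ...   | yes y∈W = ⊥-elim (noNeighbourInW y y∈W b~y)
  ...   | no  y∉W = subst (Adj b) (classOf-injective-∉ y∉W x∉W cy) b~y

  -- A vertex z ∉ W with the vector of a vertex w ∈ W of its class has no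
  -- neighbour in W: it would be adjacent to the only vertex ℓ of class
  -- `lonely` (a twin of that neighbour), so w would also be adjacent to
  -- class `lonely` ⊆ W, contradicting independence.
  noNeighbourInW : ∀ {w z} → w ∈ W → z ∉ W → classOf w ≡ classOf z → SameVector w z →
                   ∀ y → y ∈ W → ¬ Adj z y
  noNeighbourInW {w} {z} w∈W z∉W wz E y y∈W z~y with memberOf lonely
  ... | ℓ , ℓ∈W , cℓ = w-not-adjacent-to-lonely (setDist-one dw w∉lonely)
    where
      z≢ : ∀ {v} → v ∈ W → z ≢ v
      z≢ v∈W refl = z∉W v∈W
      z~ℓ : Adj z ℓ
      z~ℓ with y ≟ ℓ
      ... | yes refl = z~y
      ... | no  _    = symmetric (to (twW y ℓ y∈W ℓ∈W z (z≢ y∈W) (z≢ ℓ∈W)) (symmetric z~y))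
      dz : setDist z lonely ≤ 1
      dz = subst (λ i → setDist z i ≤ 1) cℓ (setDist-neighbour z~ℓ)
      dw : setDist w lonely ≤ 1
      dw = subst (_≤ 1) (sym (E lonely)) dz
      w∉lonely : classOf w ≢ lonely
      w∉lonely e = z∉W (lonely⊆W (trans (sym wz) e))
      w-not-adjacent-to-lonely : ¬ (∃ λ y′ → classOf y′ ≡ lonely × Adj w y′)
      w-not-adjacent-to-lonely (y′ , cy′ , w~y′) = indep w y′ w∈W (lonely⊆W cy′) w~y′

  sameVector⇒twins : ∀ {w z} → w ∈ W → z ∉ W → classOf w ≡ classOf z → SameVector w z →
                     Twins G w z
  sameVector⇒twins {w} {z} w∈W z∉W wz E x x≢w x≢z with x ∈? W
  ... | yes x∈W = mk⇔ (⊥-elim ∘ indep w x w∈W x∈W)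
                      (⊥-elim ∘ noNeighbourInW w∈W z∉W wz E x x∈W)
  ... | no  x∉W = mk⇔ (neighbour-transfer E wz (noNeighbourInW w∈W z∉W wz E) x∉W w≢x)
                      (neighbour-transfer (sym ∘ E) (sym wz) (λ y → indep w y w∈W) x∉W z≢x)
    where
      z≢x : classOf z ≢ classOf x
      z≢x e = x≢z (classOf-injective-∉ x∉W z∉W (sym e))
      w≢x : classOf w ≢ classOf x
      w≢x e = z≢x (trans (sym wz) e)

  vectors-injective : ∀ u v → SameVector u v → u ≡ v
  vectors-injective u v E with u ∈? W | v ∈? W | sameVector⇒sameClass E
  ... | yes u∈W | yes v∈W | uv = classOf-injective-∈ u∈W v∈W uv
  ... | no  u∉W | no  v∉W | uv = classOf-injective-∉ u∉W v∉W uv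
  ... | yes u∈W | no  v∉W | uv = ⊥-elim (closed u∈W v∉W (sameVector⇒twins u∈W v∉W uv E))
  ... | no  u∉W | yes v∈W | uv =
    ⊥-elim (closed v∈W u∉W (sameVector⇒twins v∈W u∉W (sym uv) (sym ∘ E)))

  upperBound : Σ (Partition G ∣ W ∣) λ P → Locating G (proj₁ P)
  upperBound = (classOf , classOf-surjective) , locating vectors-injective

mainTheorem11 : (n : ℕ) (G : Graph n) → Connected G →
    (τ : ℕ) → IsTau G τ → n < 2 * τ →
    (W : Subset n) → TauSet G τ W → Independent G W →
    IsPartitionDim G τ
mainTheorem11 n G conn .(∣ W ∣) isTau n<2τ W (twW , refl) indep =
  UpperBound.upperBound G conn W twW indep n<2τ (tauSet-closed G isTau (twW , refl)) ,
  lowerBound G W twW indep
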